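{- There is no Dumont permutation (of any length) that contains the pattern $132$ exactly once.
   Context: A permutation $\pi=\pi_1\cdots\pi_n\in S_n$ is a Dumont permutation (of the first kind) if every even entry $\pi_i$ is followed by a smaller entry ($i<n$ and $\pi_{i+1}<\pi_i$) and every odd entry $\pi_i$ is either last ($i=n$) or followed by a larger entry. An occurrence of the (classical) pattern $132$ in $\pi$ is a triple $i<j<l$ with $\pi_i<\pi_l<\pi_j$; $\pi$ contains $132$ exactly once if there is exactly one such triple. -}

module Defs where

open import Data.Nat using (ℕ; suc; _*_)
open import Data.Fin using (Fin; toℕ)
open import Data.Fin.Permutation using (Permutation′; _⟨$⟩ʳ_)
open import Data.Product using (Σ; _×_; _,_; ∃)
open import Data.Sum using (_⊎_)
open import Relation.Binary.PropositionalEquality using (_≡_)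

Even : ℕ → Set
Even m = Σ ℕ λ k → m ≡ 2 * k

Odd : ℕ → Set
Odd m = Σ ℕ λ k → m ≡ suc (2 * k)

-- A permutation π ∈ S_n is a bijection Fin n ↔ Fin n; positions are
-- i : Fin n (0-based, i.e. position i here is position i+1 in the paper),
-- and the entry π_i is the value  toℕ (π ⟨$⟩ʳ i) + 1 ∈ {1,…,n}.
entry : ∀ {n} → Permutation′ n → Fin n → ℕ
entry π i = suc (toℕ (π ⟨$⟩ʳ i))

Next : ∀ {n} → Fin n → Fin n → Set
Next i j = suc (toℕ i) ≡ toℕ j

IsLast : ∀ {n} → Fin n → Set
IsLast {n} i = suc (toℕ i) ≡ n

IsDumont : ∀ {n} → Permutation′ n → Set
IsDumont {n} π =
  (i : Fin n) →
      (Even (entry π i) → Σ (Fin n) λ j → Next i j × entry π j Data.Nat.< entry π i)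
    × (Odd (entry π i) → IsLast i ⊎ Σ (Fin n) λ j → Next i j × entry π j Data.Nat.> entry π i)
  where import Data.Nat

Occ132 : ∀ {n} → Permutation′ n → Fin n → Fin n → Fin n → Set
Occ132 π i j l =
  i Data.Fin.< j × j Data.Fin.< l
  × entry π i Data.Nat.< entry π l × entry π l Data.Nat.< entry π j
  where import Data.Fin; import Data.Nat

Contains132ExactlyOnce : ∀ {n} → Permutation′ n → Set
Contains132ExactlyOnce {n} π =
  Σ (Fin n) λ i → Σ (Fin n) λ j → Σ (Fin n) λ l →
    Occ132 π i j l
    × ((i′ j′ l′ : Fin n) → Occ132 π i′ j′ l′ → (i′ ≡ i) × (j′ ≡ j) × (l′ ≡ l))

{-# OPTIONS --safe #-}
module Submission where

-- Let a < c < b be the values of the unique occurrence, at positions i < j < l.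
-- Moving one position of the occurrence must not produce a second one; this
-- forbids entries strictly between a and c, and puts every entry strictly
-- between c and b to the left of i. An odd b would ascend into a new
-- occurrence, so b is even; then b − 1 is odd, which forces b − 1 = c. Hence
-- b = a + 2, a is even, and the smaller entry following a gives a second
-- occurrence.

open import Defs
open import Data.Nat using (ℕ; zero; suc; _≤_; _<_; s≤s; z≤n)
open import Data.Nat.Properties
  using (suc-injective; *-suc; ≤-reflexive; ≤-trans; ≤-pred; <⇒≤; ≤-<-trans; <-trans; <-irrefl; <-asym; <⇒≱;
         ≤∧≢⇒<; m≤n⇒m<n∨m≡n)
open import Data.Fin as Fin using (Fin; toℕ; fromℕ<)
import Data.Fin.Properties as Finₚ
open import Data.Fin.Permutation using (Permutation′; _⟨$⟩ʳ_; _⟨$⟩ˡ_; inverseʳ)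
open import Data.Product using (Σ; _×_; _,_; proj₁; proj₂)
open import Data.Sum using (_⊎_; inj₁; inj₂; [_,_]′; map₂)
open import Data.Empty using (⊥; ⊥-elim)
open import Function using (_∘_; id)
open import Function.Bundles using (Injection)
open import Function.Properties.Inverse using (↔⇒↣)
open import Relation.Binary using (tri<; tri≈; tri>)
open import Relation.Binary.PropositionalEquality using (_≡_; refl; sym; trans; cong; subst)
open import Relation.Nullary using (¬_)

even⊎odd : ∀ m → Even m ⊎ Odd m
even⊎odd zero = inj₁ (0 , refl)
even⊎odd (suc m) with even⊎odd m
... | inj₁ (k , m≡2k)   = inj₂ (k , cong suc m≡2k)
... | inj₂ (k , m≡1+2k) = inj₁ (suc k , trans (cong suc m≡1+2k) (sym (*-suc 2 k)))

Even-suc⇒Odd : ∀ {m} → Even (suc m) → Odd m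
Even-suc⇒Odd (zero  , ())
Even-suc⇒Odd (suc k , eq) = k , suc-injective (trans eq (*-suc 2 k))

Odd-suc⇒Even : ∀ {m} → Odd (suc m) → Even m
Odd-suc⇒Even (k , eq) = k , suc-injective eq

module _ {n : ℕ} where

  Next⇒< : ∀ {p q : Fin n} → Next p q → p Fin.< q
  Next⇒< = ≤-reflexive

  Next⇒≤ : ∀ {p q r : Fin n} → Next p q → p Fin.< r → q Fin.≤ r
  Next⇒≤ {r = r} p→q p<r = subst (_≤ toℕ r) p→q p<r

  Next⇒<∨≡ : ∀ {p q r : Fin n} → Next p q → p Fin.< r → q Fin.< r ⊎ q ≡ r
  Next⇒<∨≡ p→q p<r = map₂ Finₚ.toℕ-injective (m≤n⇒m<n∨m≡n (Next⇒≤ p→q p<r))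

  <⇒¬IsLast : ∀ {p q : Fin n} → p Fin.< q → ¬ IsLast p
  <⇒¬IsLast {q = q} p<q last = <⇒≱ (Finₚ.toℕ<n q) (subst (_≤ toℕ q) last p<q)

module _ {n : ℕ} (π : Permutation′ n) where

  entry≤n : ∀ p → entry π p ≤ n
  entry≤n p = Finₚ.toℕ<n (π ⟨$⟩ʳ p)

  entry-injective : ∀ {p q} → entry π p ≡ entry π q → p ≡ q
  entry-injective = Injection.injective (↔⇒↣ π) ∘ Finₚ.toℕ-injective ∘ suc-injective

  entry-surjective : ∀ {v} → 1 ≤ v → v ≤ n → Σ (Fin n) λ p → entry π p ≡ v
  entry-surjective {suc v} _ v<n =
    π ⟨$⟩ˡ fromℕ< v<n , cong suc (trans (cong toℕ (inverseʳ π)) (Finₚ.toℕ-fromℕ< v<n))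

module _ {n : ℕ} (π : Permutation′ n) (dumont : IsDumont π) where

  even-descent : ∀ {p} → Even (entry π p) → Σ (Fin n) λ q → Next p q × entry π q < entry π p
  even-descent {p} = proj₁ (dumont p)

  odd-ascent : ∀ {p r} → Odd (entry π p) → p Fin.< r → Σ (Fin n) λ q → Next p q × entry π p < entry π q
  odd-ascent {p} odd p<r = [ ⊥-elim ∘ <⇒¬IsLast p<r , id ]′ (proj₂ (dumont p) odd)

module UniqueOccurrence
  {n : ℕ} (π : Permutation′ n) {i j l : Fin n}
  (occ : Occ132 π i j l)
  (unique : ∀ i′ j′ l′ → Occ132 π i′ j′ l′ → (i′ ≡ i) × (j′ ≡ j) × (l′ ≡ l))
  where

  private
    E : Fin n → ℕ
    E = entry π

  i<j : i Fin.< j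
  i<j = proj₁ occ

  j<l : j Fin.< l
  j<l = proj₁ (proj₂ occ)

  a<c : E i < E l
  a<c = proj₁ (proj₂ (proj₂ occ))

  c<b : E l < E j
  c<b = proj₂ (proj₂ (proj₂ occ))

  unique-first : ∀ {p} → p Fin.< j → E p < E l → p ≡ i
  unique-first p<j p<c = proj₁ (unique _ j l (p<j , j<l , p<c , c<b))

  unique-middle : ∀ {p} → i Fin.< p → p Fin.< l → E l < E p → p ≡ j
  unique-middle i<p p<l c<p = proj₁ (proj₂ (unique i _ l (i<p , p<l , a<c , c<p)))

  unique-last : ∀ {p} → j Fin.< p → E i < E p → E p < E j → p ≡ l
  unique-last j<p a<p p<b = proj₂ (proj₂ (unique i j _ (i<j , j<p , a<p , p<b)))

  no-entry-between-first-and-last : ∀ {p} → E i < E p → E p < E l → ⊥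
  no-entry-between-first-and-last {p} a<p p<c with Finₚ.<-cmp p j
  ... | tri< p<j _ _ with unique-first p<j p<c
  ...   | refl = <-irrefl refl a<p
  no-entry-between-first-and-last a<p p<c | tri≈ _ refl _ = <-asym p<c c<b
  no-entry-between-first-and-last a<p p<c | tri> _ _ j<p with unique-last j<p a<p (<-trans p<c c<b)
  ...   | refl = <-irrefl refl p<c

  between-last-and-middle⇒before-first : ∀ {p} → E l < E p → E p < E j → p Fin.< i
  between-last-and-middle⇒before-first {p} c<p p<b with Finₚ.<-cmp p j
  ... | tri≈ _ refl _ = ⊥-elim (<-irrefl refl p<b)
  ... | tri> _ _ j<p with unique-last j<p (<-trans a<c c<p) p<b
  ...   | refl = ⊥-elim (<-irrefl refl c<p)
  between-last-and-middle⇒before-first {p} c<p p<b | tri< p<j _ _ with Finₚ.<-cmp p i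
  ... | tri< p<i _ _ = p<i
  ... | tri≈ _ refl _ = ⊥-elim (<-asym c<p a<c)
  ... | tri> _ _ i<p = ⊥-elim (Finₚ.<⇒≢ p<j (unique-middle i<p (<-trans p<j j<l) c<p))

  last≡suc-first : E l ≡ suc (E i)
  last≡suc-first with m≤n⇒m<n∨m≡n a<c
  ... | inj₂ 1+a≡c = sym 1+a≡c
  ... | inj₁ 1+a<c with entry-surjective π (s≤s z≤n) (≤-trans (<⇒≤ 1+a<c) (entry≤n π l))
  ...   | p , p≡1+a =
          ⊥-elim (no-entry-between-first-and-last (≤-reflexive (sym p≡1+a)) (subst (_< E l) (sym p≡1+a) 1+a<c))

  module _ (dumont : IsDumont π) where

    middle-even : Even (E j)
    middle-even with even⊎odd (E j)
    ... | inj₁ even = even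
    ... | inj₂ odd with odd-ascent π dumont odd j<l
    ...   | q , j→q , b<q with Next⇒<∨≡ j→q j<l
    ...     | inj₁ q<l =
              ⊥-elim (Finₚ.<⇒≢ (Next⇒< j→q) (sym (unique-middle (<-trans i<j (Next⇒< j→q)) q<l (<-trans c<b b<q))))
    ...     | inj₂ refl = ⊥-elim (<-asym c<b b<q)

    -- The odd entry p ascends to a position q left of j with an entry above b, so (p, q, j) is a 132 occurrence.
    no-predecessor-of-middle-above-last : ∀ {p} → E l < E p → suc (E p) ≡ E j → ⊥
    no-predecessor-of-middle-above-last {p} c<p p+1≡b = no-ascent (odd-ascent π dumont p-odd p<i)
      where
      p-odd : Odd (E p)
      p-odd = Even-suc⇒Odd (subst Even (sym p+1≡b) middle-even)

      p<i : p Fin.< i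
      p<i = between-last-and-middle⇒before-first c<p (≤-reflexive p+1≡b)

      no-ascent : ¬ (Σ (Fin n) λ q → Next p q × E p < E q)
      no-ascent (q , p→q , p<q) =
        Finₚ.<⇒≢ q<j (proj₁ (proj₂ (unique p q j (Next⇒< p→q , q<j , ≤-reflexive p+1≡b , b<q))))
        where
        q<j : q Fin.< j
        q<j = ≤-<-trans (Next⇒≤ p→q p<i) i<j

        b<q : E j < E q
        b<q = ≤∧≢⇒< (subst (_≤ E q) p+1≡b p<q) (Finₚ.<⇒≢ q<j ∘ sym ∘ entry-injective π)

    middle≡suc-last : E j ≡ suc (E l)
    middle≡suc-last with m≤n⇒m<n∨m≡n c<b
    ... | inj₂ 1+c≡b = sym 1+c≡b
    ... | inj₁ 2+c≤b with entry-surjective π (≤-trans (s≤s z≤n) (≤-pred 2+c≤b)) (<⇒≤ (entry≤n π j))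
    ...   | p , p≡b-1 =
            ⊥-elim (no-predecessor-of-middle-above-last (subst (E l <_) (sym p≡b-1) (≤-pred 2+c≤b)) (cong suc p≡b-1))

    first-even : Even (E i)
    first-even = Odd-suc⇒Even (Even-suc⇒Odd (subst Even b≡2+a middle-even))
      where
      b≡2+a : E j ≡ suc (suc (E i))
      b≡2+a = trans middle≡suc-last (cong suc last≡suc-first)

    contradiction : ⊥
    contradiction with even-descent π dumont first-even
    ... | q , i→q , q<a with Next⇒<∨≡ i→q i<j
    ...   | inj₁ q<j = Finₚ.<⇒≢ (Next⇒< i→q) (sym (unique-first q<j (<-trans q<a a<c)))
    ...   | inj₂ refl = <-asym q<a (<-trans a<c c<b)

theorem4p1 : (n : ℕ) (π : Permutation′ n) → ¬ (IsDumont π × Contains132ExactlyOnce π)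
theorem4p1 n π (dumont , i , j , l , occ , unique) = UniqueOccurrence.contradiction π occ unique dumont
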